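{- Let $G$ be a doubly transitive permutation group on $n\geq3$ points, $G_0\leq G$ the stabilizer of a point, $\pi\colon G^*\to G$ a Schur covering, $G_0^*=\pi^{ -1}(G_0)$, and $\alpha\colon G_0^*\to C_{r'}$ a surjective linear character. Put $r=2r'$, $\widetilde{G}^*=G^*\times C_r$, $\widetilde\alpha(x,z)=z\,\alpha(x)$ on $G_0^*\times C_r$, and $H=\ker\widetilde\alpha$. Assume $(\widetilde G^*,H)$ is a Higman pair. Given $x\in G^*\setminus G_0^*$, there exist $\xi,\eta\in G_0^*$ such that $x^{ -1}=\xi x\eta$; and for any such $\xi,\eta$ and either $z\in C_r$ with $z^2=\alpha(\xi\eta)$, the element $(x,z)$ is a key for the Higman pair $(\widetilde G^*,H)$.
   Context: $C_m\leq\mathbb{C}^\times$ is the group of $m$th roots of unity. Schur covering: epimorphism $\pi\colon G^*\to G$ whose kernel lies in the center and the commutator subgroup of $G^*$ and is isomorphic to the Schur multiplier of $G$. For a finite group $\Gamma$ and proper subgroup $H$ with $K=N_\Gamma(H)$, $(\Gamma,H)$ is a Higman pair if there exists $b\in\Gamma\setminus K$ (called a key) with (H1) $\Gamma$ acts doubly transitively on $\Gamma/K$; (H2) $K/H$ is abelian; (H3) $HbH=Hb^{ -1}H$; (H4) $aba^{ -1}\in HbH$ for every $a\in K$; (H5) if $a\in K$ and $ab\in HbH$ then $a\in H$. -}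

module Defs where

open import Level using (0ℓ)
open import Algebra.Bundles using (Group)
import Algebra.Construct.DirectProduct as DP
open import Data.Nat as ℕ using (ℕ; _≥_)
open import Data.Integer as ℤ using (ℤ; +_; _-_; -_; _+_; _*_; 0ℤ)
open import Data.Integer.Properties as ℤP using ()
open import Data.Integer.Divisibility.Signed using (_∣_; divides; ∣m∣n⇒∣m+n; ∣m⇒∣-m)
open import Data.Integer.Tactic.RingSolver using (solve-∀)
open import Data.Fin using (Fin)
open import Data.Bool using (Bool; not)
open import Data.List using (List; []; _∷_; _++_; reverse; map)
open import Data.Product using (Σ; ∃; ∃₂; _×_; _,_; proj₁; proj₂)
open import Relation.Binary.PropositionalEquality as Eq using (_≡_; _≢_)
open import Relation.Binary.Construct.Closure.Equivalence using (EqClosure)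
open import Relation.Nullary using (¬_)

-- Congruence modulo m on ℤ, and the cyclic group C_m modelled as ℤ/mℤ
-- (additively; C_m ≅ ℤ/mℤ via k ↦ exp(2πik/m)).

infix 4 _≡_[mod_]
_≡_[mod_] : ℤ → ℤ → ℕ → Set
a ≡ b [mod m ] = (+ m) ∣ (a - b)

private
  eq⇒mod : ∀ {m} {a b : ℤ} → a ≡ b → a ≡ b [mod m ]
  eq⇒mod {m} {a} Eq.refl = divides 0ℤ (Eq.trans (ℤP.+-inverseʳ a) (Eq.sym (ℤP.*-zeroˡ (+ m))))

  l-sym : ∀ a b → - (a - b) ≡ b - a
  l-sym = solve-∀
  l-trans : ∀ a b c → (a - b) + (b - c) ≡ a - c
  l-trans = solve-∀
  l-cong : ∀ a b c d → (a - b) + (c - d) ≡ (a + c) - (b + d)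
  l-cong = solve-∀
  l-neg : ∀ a b → - (a - b) ≡ (- a) - (- b)
  l-neg = solve-∀

  subst∣ : ∀ {k x y} → x ≡ y → k ∣ x → k ∣ y
  subst∣ Eq.refl p = p

Cyc : ℕ → Group 0ℓ 0ℓ
Cyc m = record
  { Carrier = ℤ
  ; _≈_ = λ a b → a ≡ b [mod m ]
  ; _∙_ = _+_
  ; ε = 0ℤ
  ; _⁻¹ = -_
  ; isGroup = record
    { isMonoid = record
      { isSemigroup = record
        { isMagma = record
          { isEquivalence = record
            { refl = λ {a} → eq⇒mod {a = a} Eq.refl
            ; sym = λ {a} {b} p → subst∣ (l-sym a b) (∣m⇒∣-m p)
            ; trans = λ {a} {b} {c} p q → subst∣ (l-trans a b c) (∣m∣n⇒∣m+n p q)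
            }
          ; ∙-cong = λ {a} {b} {c} {d} p q → subst∣ (l-cong a b c d) (∣m∣n⇒∣m+n p q)
          }
        ; assoc = λ a b c → eq⇒mod (ℤP.+-assoc a b c)
        }
      ; identity = (λ a → eq⇒mod (ℤP.+-identityˡ a)) , (λ a → eq⇒mod (ℤP.+-identityʳ a))
      }
    ; inverse = (λ a → eq⇒mod (ℤP.+-inverseˡ a)) , (λ a → eq⇒mod (ℤP.+-inverseʳ a))
    ; ⁻¹-cong = λ {a} {b} p → subst∣ (l-neg a b) (∣m⇒∣-m p)
    }
  }

module GroupNotions (Γ : Group 0ℓ 0ℓ) where
  open Group Γ

  Pred : Set₁
  Pred = Carrier → Set

  Finite : Set
  Finite = Σ ℕ λ m → Σ (Fin m → Carrier) λ f → ∀ x → ∃ λ i → f i ≈ x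

  record IsSubgroup (S : Pred) : Set where
    field
      resp : ∀ {x y} → x ≈ y → S x → S y
      one  : S ε
      mul  : ∀ {x y} → S x → S y → S (x ∙ y)
      inv  : ∀ {x} → S x → S (x ⁻¹)

  data Gen (S : Pred) : Pred where
    gen  : ∀ {x} → S x → Gen S x
    one  : Gen S ε
    mul  : ∀ {x y} → Gen S x → Gen S y → Gen S (x ∙ y)
    inv  : ∀ {x} → Gen S x → Gen S (x ⁻¹)
    resp : ∀ {x y} → x ≈ y → Gen S x → Gen S y

  [_,_] : Carrier → Carrier → Carrier
  [ a , b ] = ((a ⁻¹ ∙ b ⁻¹) ∙ a) ∙ b

  IsCommutator : Pred
  IsCommutator x = ∃₂ λ a b → x ≈ [ a , b ]

  Derived : Pred
  Derived = Gen IsCommutator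

  Center : Pred
  Center z = ∀ g → z ∙ g ≈ g ∙ z

  Normalizer : Pred → Pred
  Normalizer S a = ∀ h → S h → S ((a ∙ h) ∙ a ⁻¹) × S ((a ⁻¹ ∙ h) ∙ a)

  Proper : Pred → Set
  Proper S = ∃ λ x → ¬ S x

  DoubleCoset : Pred → Carrier → Pred
  DoubleCoset S g x = ∃₂ λ h h' → S h × S h' × x ≈ (h ∙ g) ∙ h'

  SameCoset : Pred → Carrier → Carrier → Set
  SameCoset K g g' = K (g ⁻¹ ∙ g')

  DoublyTransitiveOnCosets : Pred → Set
  DoublyTransitiveOnCosets K =
    ∀ g₁ g₂ g₃ g₄ → ¬ SameCoset K g₁ g₂ → ¬ SameCoset K g₃ g₄ →
    ∃ λ γ → SameCoset K (γ ∙ g₁) g₃ × SameCoset K (γ ∙ g₂) g₄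

  record IsKey (H : Pred) (b : Carrier) : Set where
    K = Normalizer H
    field
      notInK : ¬ K b
      H1 : DoublyTransitiveOnCosets K
      H2 : ∀ a a' → K a → K a' → H [ a , a' ]          -- K/H abelian
      H3 : ∀ x → (DoubleCoset H b x → DoubleCoset H (b ⁻¹) x)
                × (DoubleCoset H (b ⁻¹) x → DoubleCoset H b x)
      H4 : ∀ a → K a → DoubleCoset H b ((a ∙ b) ∙ a ⁻¹)
      H5 : ∀ a → K a → DoubleCoset H b (a ∙ b) → H a

  HigmanPair : Pred → Set
  HigmanPair H = Finite × IsSubgroup H × Proper H × ∃ λ b → IsKey H b

-- Schur multiplier via Hopf's formula M(G) = (R ∩ [F,F]) / [F,R],
-- for the free presentation F → G with F free on the elements of G.

module Hopf (G : Group 0ℓ 0ℓ) where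
  open Group G

  -- words in the free group on Carrier; (x , true) is the letter x⁻¹
  Word : Set
  Word = List (Carrier × Bool)

  eval : Word → Carrier
  eval [] = ε
  eval ((x , Bool.false) ∷ w) = x ∙ eval w
  eval ((x , Bool.true) ∷ w) = x ⁻¹ ∙ eval w

  -- one step of free-group equality (letters of the setoid are identified up to ≈)
  data Step : Word → Word → Set where
    cancel : ∀ u v x y b → x ≈ y → Step (u ++ (x , b) ∷ (y , not b) ∷ v) (u ++ v)
    swap   : ∀ u v x y b → x ≈ y → Step (u ++ (x , b) ∷ v) (u ++ (y , b) ∷ v)

  _~_ : Word → Word → Set
  _~_ = EqClosure Step

  winv : Word → Word
  winv w = reverse (map (λ p → proj₁ p , not (proj₂ p)) w)

  data FGen (S : Word → Set) : Word → Set where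
    gen  : ∀ {w} → S w → FGen S w
    one  : FGen S []
    mul  : ∀ {w v} → FGen S w → FGen S v → FGen S (w ++ v)
    inv  : ∀ {w} → FGen S w → FGen S (winv w)
    resp : ∀ {w v} → w ~ v → FGen S w → FGen S v

  fcomm : Word → Word → Word
  fcomm a b = winv a ++ winv b ++ a ++ b

  InR : Word → Set
  InR w = eval w ≈ ε

  FDerived : Word → Set
  FDerived = FGen (λ w → ∃₂ λ a b → w ≡ fcomm a b)

  FR : Word → Set
  FR = FGen (λ w → ∃₂ λ a r → InR r × w ≡ fcomm a r)

  InHopf : Word → Set
  InHopf w = InR w × FDerived w

  _≈M_ : Word → Word → Set
  w ≈M v = FR (w ++ winv v)

module _ (G* G : Group 0ℓ 0ℓ) where
  private
    module S = Group G*
    module T = Group G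

  record IsEpimorphism (π : S.Carrier → T.Carrier) : Set where
    field
      cong : ∀ {x y} → x S.≈ y → π x T.≈ π y
      hom  : ∀ x y → π (x S.∙ y) T.≈ π x T.∙ π y
      surj : ∀ g → ∃ λ x → π x T.≈ g

  record IsSchurCovering (π : S.Carrier → T.Carrier) : Set where
    open GroupNotions G* using (Center; Derived)
    open Hopf G
    field
      epi : IsEpimorphism π
      kerCentral : ∀ x → π x T.≈ T.ε → Center x
      kerDerived : ∀ x → π x T.≈ T.ε → Derived x
      ψ : Word → S.Carrier
      ψ-ker  : ∀ w → InHopf w → π (ψ w) T.≈ T.ε
      ψ-cong : ∀ w v → InHopf w → InHopf v → w ≈M v → ψ w S.≈ ψ v
      ψ-hom  : ∀ w v → InHopf w → InHopf v → ψ (w ++ v) S.≈ ψ w S.∙ ψ v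
      ψ-inj  : ∀ w v → InHopf w → InHopf v → ψ w S.≈ ψ v → w ≈M v
      ψ-surj : ∀ x → π x T.≈ T.ε → ∃ λ w → InHopf w × ψ w S.≈ x

record IsPermutationGroup (n : ℕ) (G : Group 0ℓ 0ℓ)
                          (act : Group.Carrier G → Fin n → Fin n) : Set where
  open Group G
  field
    act-cong : ∀ {g h} → g ≈ h → ∀ i → act g i ≡ act h i
    act-ε    : ∀ i → act ε i ≡ i
    act-∙    : ∀ g h i → act (g ∙ h) i ≡ act g (act h i)
    faithful : ∀ g → (∀ i → act g i ≡ i) → g ≈ ε

DoublyTransitive : ∀ {n} (G : Group 0ℓ 0ℓ) → (Group.Carrier G → Fin n → Fin n) → Set
DoublyTransitive G act =
  ∀ i j k l → i ≢ j → k ≢ l → ∃ λ g → act g i ≡ k × act g j ≡ l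

Gtilde : Group 0ℓ 0ℓ → ℕ → Group 0ℓ 0ℓ
Gtilde G* r = DP.group G* (Cyc r)

record IsSurjLinearChar (G* : Group 0ℓ 0ℓ) (G₀* : Group.Carrier G* → Set)
                        (r' : ℕ) (α : Group.Carrier G* → ℤ) : Set where
  open Group G*
  field
    cong : ∀ x y → G₀* x → G₀* y → x ≈ y → α x ≡ α y [mod r' ]
    hom  : ∀ x y → G₀* x → G₀* y → α (x ∙ y) ≡ α x + α y [mod r' ]
    surj : ∀ k → ∃ λ x → G₀* x × α x ≡ k [mod r' ]

-- H = ker α̃ where α̃(x,z) = z·α(x) on G₀* × C_r; the inclusion
-- C_{r'} ⊆ C_r (r = 2r') is k ↦ 2k in additive notation.
Hker : (G* : Group 0ℓ 0ℓ) → (Group.Carrier G* → Set) → ℕ → (Group.Carrier G* → ℤ) →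
       Group.Carrier G* × ℤ → Set
Hker G* G₀* r α (x , z) = G₀* x × (z + + 2 * α x ≡ 0ℤ [mod r ])

Stab* : ∀ {n} (G* G : Group 0ℓ 0ℓ) → (Group.Carrier G → Fin n → Fin n) →
        (Group.Carrier G* → Group.Carrier G) → Fin n → Group.Carrier G* → Set
Stab* G* G act π p x = act (π x) p ≡ p

-- Let S = G₀* and K = N(H).  As G is doubly transitive on n ≥ 3 points, S is
-- self-normalising and G* ∖ S is a single double coset S x S; hence K = S × C_r
-- and x⁻¹ = ξ x η with ξ, η ∈ S.  (H1) and (H2) concern only K, and (H3), (H4)
-- are direct computations once 2z = 2α(ξη).  The substance is (H5), which
-- reduces to 2α(x v x⁻¹) = 2α(v) whenever v and x v x⁻¹ lie in S.  This
-- invariance is read off from (H5) for the key x₀ that the Higman pair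
-- provides, and transported to every x ∉ S through x ∈ S x₀ S.

module Submission where

open import Defs
open import Level using (0ℓ)
open import Algebra.Bundles using (Group)
import Algebra.Properties.Group as GroupProperties
open import Data.Nat using (ℕ; _≥_; s≤s)
open import Data.Integer using (ℤ; +_; _*_; _+_; -_; _-_; 0ℤ)
import Data.Integer.Properties as ℤP
open import Data.Integer.Divisibility.Signed using (_∣_; *-monoʳ-∣)
open import Data.Integer.Tactic.RingSolver using (solve-∀)
open import Data.Fin using (Fin; zero; suc; _≟_)
open import Data.Product using (∃; ∃₂; _×_; _,_; proj₁; proj₂)
open import Relation.Nullary using (¬_; Dec; yes; no; contradiction)
open import Relation.Binary.PropositionalEquality as Eq using (_≡_; _≢_)
import Relation.Binary.Reasoning.Setoid as SetoidReasoning

module GroupLemmas (Γ : Group 0ℓ 0ℓ) where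
  open Group Γ
  open GroupProperties Γ
  open SetoidReasoning setoid
  open GroupNotions Γ using (IsSubgroup; DoubleCoset)

  conj : Carrier → Carrier → Carrier
  conj a w = (a ∙ w) ∙ a ⁻¹

  conj-cong : ∀ {a a' w w'} → a ≈ a' → w ≈ w' → conj a w ≈ conj a' w'
  conj-cong a≈a' w≈w' = ∙-cong (∙-cong a≈a' w≈w') (⁻¹-cong a≈a')

  conj-ε : ∀ w → conj ε w ≈ w
  conj-ε w = begin
    (ε ∙ w) ∙ ε ⁻¹  ≈⟨ ∙-cong (identityˡ w) ε⁻¹≈ε ⟩
    w ∙ ε           ≈⟨ identityʳ w ⟩
    w               ∎

  conj-∙ : ∀ a b w → conj (a ∙ b) w ≈ conj a (conj b w)
  conj-∙ a b w = begin
    ((a ∙ b) ∙ w) ∙ (a ∙ b) ⁻¹       ≈⟨ ∙-congˡ (⁻¹-anti-homo-∙ a b) ⟩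
    ((a ∙ b) ∙ w) ∙ (b ⁻¹ ∙ a ⁻¹)    ≈⟨ assoc _ _ _ ⟨
    (((a ∙ b) ∙ w) ∙ b ⁻¹) ∙ a ⁻¹    ≈⟨ ∙-congʳ (∙-congʳ (assoc a b w)) ⟩
    ((a ∙ (b ∙ w)) ∙ b ⁻¹) ∙ a ⁻¹    ≈⟨ ∙-congʳ (assoc a (b ∙ w) (b ⁻¹)) ⟩
    (a ∙ ((b ∙ w) ∙ b ⁻¹)) ∙ a ⁻¹    ∎

  conj-⁻¹-conj : ∀ a w → conj (a ⁻¹) (conj a w) ≈ w
  conj-⁻¹-conj a w = begin
    conj (a ⁻¹) (conj a w)  ≈⟨ conj-∙ (a ⁻¹) a w ⟨
    conj (a ⁻¹ ∙ a) w       ≈⟨ conj-cong (inverseˡ a) refl ⟩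
    conj ε w                ≈⟨ conj-ε w ⟩
    w                       ∎

  conj-x⁻¹≈x⁻¹∙w∙x : ∀ x w → conj (x ⁻¹) w ≈ (x ⁻¹ ∙ w) ∙ x
  conj-x⁻¹≈x⁻¹∙w∙x x w = ∙-congˡ (⁻¹-involutive x)

  conj∙x≈ε∙x∙w : ∀ x w → conj x w ∙ x ≈ (ε ∙ x) ∙ w
  conj∙x≈ε∙x∙w x w = trans (//-rightDividesˡ x (x ∙ w)) (∙-congʳ (sym (identityˡ x)))

  x≈a∙y∙c⇒y≈a⁻¹∙x∙c⁻¹ : ∀ {x a y c} → x ≈ (a ∙ y) ∙ c → y ≈ (a ⁻¹ ∙ x) ∙ c ⁻¹
  x≈a∙y∙c⇒y≈a⁻¹∙x∙c⁻¹ {x} {a} {y} {c} e = sym (begin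
    (a ⁻¹ ∙ x) ∙ c ⁻¹                ≈⟨ ∙-congʳ (∙-congˡ e) ⟩
    (a ⁻¹ ∙ ((a ∙ y) ∙ c)) ∙ c ⁻¹    ≈⟨ ∙-congʳ (∙-congˡ (assoc a y c)) ⟩
    (a ⁻¹ ∙ (a ∙ (y ∙ c))) ∙ c ⁻¹    ≈⟨ ∙-congʳ (\\-leftDividesʳ a (y ∙ c)) ⟩
    (y ∙ c) ∙ c ⁻¹                   ≈⟨ //-rightDividesʳ c y ⟩
    y                                ∎)

  y∙x≈u∙x∙v⇒u⁻¹∙y≈conj : ∀ {y x u v} → y ∙ x ≈ (u ∙ x) ∙ v → u ⁻¹ ∙ y ≈ conj x v
  y∙x≈u∙x∙v⇒u⁻¹∙y≈conj {y} {x} {u} {v} e = begin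
    u ⁻¹ ∙ y                        ≈⟨ ∙-congˡ (//-rightDividesʳ x y) ⟨
    u ⁻¹ ∙ ((y ∙ x) ∙ x ⁻¹)         ≈⟨ ∙-congˡ (∙-congʳ e) ⟩
    u ⁻¹ ∙ (((u ∙ x) ∙ v) ∙ x ⁻¹)   ≈⟨ ∙-congˡ (∙-congʳ (assoc u x v)) ⟩
    u ⁻¹ ∙ ((u ∙ (x ∙ v)) ∙ x ⁻¹)   ≈⟨ ∙-congˡ (assoc u (x ∙ v) (x ⁻¹)) ⟩
    u ⁻¹ ∙ (u ∙ ((x ∙ v) ∙ x ⁻¹))   ≈⟨ \\-leftDividesʳ u _ ⟩
    conj x v                        ∎

  x∙y∙[z∙x∙y]⁻¹≈z⁻¹ : ∀ x y z → (x ∙ y) ∙ ((z ∙ x) ∙ y) ⁻¹ ≈ z ⁻¹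
  x∙y∙[z∙x∙y]⁻¹≈z⁻¹ x y z = begin
    (x ∙ y) ∙ ((z ∙ x) ∙ y) ⁻¹        ≈⟨ ∙-congˡ (⁻¹-anti-homo-∙ (z ∙ x) y) ⟩
    (x ∙ y) ∙ (y ⁻¹ ∙ (z ∙ x) ⁻¹)     ≈⟨ assoc _ _ _ ⟨
    ((x ∙ y) ∙ y ⁻¹) ∙ (z ∙ x) ⁻¹     ≈⟨ ∙-congʳ (//-rightDividesʳ y x) ⟩
    x ∙ (z ∙ x) ⁻¹                    ≈⟨ ∙-congˡ (⁻¹-anti-homo-∙ z x) ⟩
    x ∙ (x ⁻¹ ∙ z ⁻¹)                 ≈⟨ \\-leftDividesˡ x (z ⁻¹) ⟩
    z ⁻¹                              ∎

  -- A constructive form of N(S) ⊆ S.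
  SelfNormalizing : (Carrier → Set) → Set
  SelfNormalizing S = ∀ {y} → ¬ S y → ∃ λ ξ → S ξ × ¬ S (conj y ξ)

  ComplementIsDoubleCoset : (Carrier → Set) → Set
  ComplementIsDoubleCoset S =
    ∀ {x x₀} → ¬ S x → ¬ S x₀ → ∃₂ λ k₁ k₂ → S k₁ × S k₂ × x ≈ (k₁ ∙ x₀) ∙ k₂

  module _ {S : Carrier → Set} (S-sub : IsSubgroup S) where
    open IsSubgroup S-sub

    conj-closed : ∀ {a w} → S a → S w → S (conj a w)
    conj-closed sa sw = mul (mul sa sw) (inv sa)

    conj-reflect : ∀ {a w} → S a → S (conj a w) → S w
    conj-reflect {a} {w} sa s = resp (conj-⁻¹-conj a w) (conj-closed (inv sa) s)

    doubleCoset-⊆ : ∀ {b b' h₁ h₂} → b' ≈ (h₁ ∙ b) ∙ h₂ → S h₁ → S h₂ →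
                    ∀ {g} → DoubleCoset S b' g → DoubleCoset S b g
    doubleCoset-⊆ {b} {b'} {h₁} {h₂} e sh₁ sh₂ {g} (h , h' , sh , sh' , g≈) =
      h ∙ h₁ , h₂ ∙ h' , mul sh sh₁ , mul sh₂ sh' , (begin
        g                             ≈⟨ g≈ ⟩
        (h ∙ b') ∙ h'                 ≈⟨ ∙-congʳ (∙-congˡ e) ⟩
        (h ∙ ((h₁ ∙ b) ∙ h₂)) ∙ h'    ≈⟨ ∙-congʳ (∙-congˡ (assoc h₁ b h₂)) ⟩
        (h ∙ (h₁ ∙ (b ∙ h₂))) ∙ h'    ≈⟨ ∙-congʳ (assoc h h₁ (b ∙ h₂)) ⟨
        ((h ∙ h₁) ∙ (b ∙ h₂)) ∙ h'    ≈⟨ assoc _ _ _ ⟩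
        (h ∙ h₁) ∙ ((b ∙ h₂) ∙ h')    ≈⟨ ∙-congˡ (assoc b h₂ h') ⟩
        (h ∙ h₁) ∙ (b ∙ (h₂ ∙ h'))    ≈⟨ assoc _ _ _ ⟨
        ((h ∙ h₁) ∙ b) ∙ (h₂ ∙ h')    ∎)

module ≡-mod-Reasoning (m : ℕ) where
  open SetoidReasoning (Group.setoid (Cyc m)) public

  -- The implicit arguments of the group laws of Cyc m cannot be inferred,
  -- since its equality unfolds to a divisibility of a difference.
  +-cong : ∀ a b c d → a ≡ b [mod m ] → c ≡ d [mod m ] → a + c ≡ b + d [mod m ]
  +-cong a b c d = Group.∙-cong (Cyc m) {a} {b} {c} {d}

  +-congˡ : ∀ a c d → c ≡ d [mod m ] → a + c ≡ a + d [mod m ]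
  +-congˡ a c d = Group.∙-congˡ (Cyc m) {a} {c} {d}

  +-congʳ : ∀ a b c → a ≡ b [mod m ] → a + c ≡ b + c [mod m ]
  +-congʳ a b c = Group.∙-congʳ (Cyc m) {c} {a} {b}

  -‿cong : ∀ a b → a ≡ b [mod m ] → - a ≡ - b [mod m ]
  -‿cong a b = Group.⁻¹-cong (Cyc m) {a} {b}

*2-mono-mod : ∀ {m} a b → a ≡ b [mod m ] → + 2 * a ≡ + 2 * b [mod 2 Data.Nat.* m ]
*2-mono-mod {m} a b a≡b =
  Eq.subst₂ _∣_ (Eq.sym (ℤP.pos-* 2 m)) (*-distribˡ-minus (+ 2) a b) (*-monoʳ-∣ (+ 2) a≡b)
  where
  *-distribˡ-minus : ∀ k a b → k * (a - b) ≡ k * a - k * b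
  *-distribˡ-minus = solve-∀

record IsCharacterOn (Γ : Group 0ℓ 0ℓ) (S : Group.Carrier Γ → Set) (m : ℕ)
                     (χ : Group.Carrier Γ → ℤ) : Set where
  open Group Γ
  field
    cong : ∀ {x y} → S x → S y → x ≈ y → χ x ≡ χ y [mod m ]
    hom  : ∀ {x y} → S x → S y → χ (x ∙ y) ≡ χ x + χ y [mod m ]

doubled-isCharacterOn : ∀ {G* S r' α} → IsSurjLinearChar G* S r' α →
                        IsCharacterOn G* S (2 Data.Nat.* r') (λ x → + 2 * α x)
doubled-isCharacterOn {G*} {S} {r'} {α} isα = record
  { cong = λ {x} {y} sx sy x≈y → *2-mono-mod (α x) (α y) (cong x y sx sy x≈y)
  ; hom  = λ {x} {y} sx sy → begin
      + 2 * α (x ∙ y)          ≈⟨ *2-mono-mod (α (x ∙ y)) (α x + α y) (hom x y sx sy) ⟩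
      + 2 * (α x + α y)        ≡⟨ ℤP.*-distribˡ-+ (+ 2) (α x) (α y) ⟩
      + 2 * α x + + 2 * α y    ∎
  }
  where
  open Group G* using (_∙_)
  open IsSurjLinearChar isα
  open ≡-mod-Reasoning (2 Data.Nat.* r')

module CharacterProperties {Γ : Group 0ℓ 0ℓ} {S : Group.Carrier Γ → Set} {m : ℕ}
                           {χ : Group.Carrier Γ → ℤ}
                           (S-sub : GroupNotions.IsSubgroup Γ S)
                           (isχ : IsCharacterOn Γ S m χ) where
  open Group Γ
  open GroupNotions.IsSubgroup S-sub
  open IsCharacterOn isχ
  open GroupLemmas Γ using (conj)
  open ≡-mod-Reasoning m
  private module ℤₘ = GroupProperties (Cyc m)

  χ-ε : χ ε ≡ 0ℤ [mod m ]
  χ-ε = ℤₘ.identityˡ-unique (χ ε) (χ ε) (begin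
    χ ε + χ ε    ≈⟨ hom one one ⟨
    χ (ε ∙ ε)    ≈⟨ cong (mul one one) one (identityˡ ε) ⟩
    χ ε          ∎)

  χ-⁻¹ : ∀ {y} → S y → χ (y ⁻¹) ≡ - χ y [mod m ]
  χ-⁻¹ {y} sy = ℤₘ.inverseʳ-unique (χ y) (χ (y ⁻¹)) (begin
    χ y + χ (y ⁻¹)   ≈⟨ hom sy (inv sy) ⟨
    χ (y ∙ y ⁻¹)     ≈⟨ cong (mul sy (inv sy)) one (inverseʳ y) ⟩
    χ ε              ≈⟨ χ-ε ⟩
    0ℤ               ∎)

  χ-conj : ∀ {k v} → S k → S v → χ (conj k v) ≡ χ v [mod m ]
  χ-conj {k} {v} sk sv = begin
    χ ((k ∙ v) ∙ k ⁻¹)      ≈⟨ hom (mul sk sv) (inv sk) ⟩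
    χ (k ∙ v) + χ (k ⁻¹)    ≈⟨ +-cong (χ (k ∙ v)) (χ k + χ v) (χ (k ⁻¹)) (- χ k) (hom sk sv) (χ-⁻¹ sk) ⟩
    (χ k + χ v) + - χ k     ≡⟨ cancel (χ k) (χ v) ⟩
    χ v                     ∎
    where
    cancel : ∀ a b → (a + b) + - a ≡ b
    cancel = solve-∀

record IsAction {n : ℕ} (Γ : Group 0ℓ 0ℓ) (A : Group.Carrier Γ → Fin n → Fin n) : Set where
  open Group Γ
  field
    act-cong : ∀ {g h} → g ≈ h → ∀ i → A g i ≡ A h i
    act-ε    : ∀ i → A ε i ≡ i
    act-∙    : ∀ g h i → A (g ∙ h) i ≡ A g (A h i)

module _ {G* G : Group 0ℓ 0ℓ} {π : Group.Carrier G* → Group.Carrier G}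
         (epi : IsEpimorphism G* G π) {n : ℕ} {act : Group.Carrier G → Fin n → Fin n}
         (isPerm : IsPermutationGroup n G act) where
  private
    module G* = Group G*
    module G = Group G
  open IsEpimorphism epi
  open IsPermutationGroup isPerm

  pullback-isAction : IsAction G* (λ y → act (π y))
  pullback-isAction = record
    { act-cong = λ y≈y' i → act-cong (cong y≈y') i
    ; act-ε    = λ i → Eq.trans (act-cong π-ε i) (act-ε i)
    ; act-∙    = λ y y' i → Eq.trans (act-cong (hom y y') i) (act-∙ (π y) (π y') i)
    }
    where
    π-ε : π G*.ε G.≈ G.ε
    π-ε = GroupProperties.identityˡ-unique G (π G*.ε) (π G*.ε)
            (G.trans (G.sym (hom G*.ε G*.ε)) (cong (G*.identityˡ G*.ε)))

  pullback-doublyTransitive : DoublyTransitive G act → DoublyTransitive G* (λ y → act (π y))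
  pullback-doublyTransitive dt i j k l i≢j k≢l with dt i j k l i≢j k≢l
  ... | g , gi≡k , gj≡l with surj g
  ... | y , πy≈g = y , Eq.trans (act-cong πy≈g i) gi≡k , Eq.trans (act-cong πy≈g j) gj≡l

third-point : ∀ {n} → n ≥ 3 → (p q : Fin n) → ∃ λ s → s ≢ p × s ≢ q
third-point (s≤s (s≤s (s≤s _))) zero zero = suc zero , (λ ()) , (λ ())
third-point (s≤s (s≤s (s≤s _))) zero (suc zero) = suc (suc zero) , (λ ()) , (λ ())
third-point (s≤s (s≤s (s≤s _))) zero (suc (suc _)) = suc zero , (λ ()) , (λ ())
third-point (s≤s (s≤s (s≤s _))) (suc zero) zero = suc (suc zero) , (λ ()) , (λ ())
third-point (s≤s (s≤s (s≤s _))) (suc zero) (suc _) = zero , (λ ()) , (λ ())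
third-point (s≤s (s≤s (s≤s _))) (suc (suc _)) zero = suc zero , (λ ()) , (λ ())
third-point (s≤s (s≤s (s≤s _))) (suc (suc _)) (suc _) = zero , (λ ()) , (λ ())

module Stabilizer {n : ℕ} (Γ : Group 0ℓ 0ℓ) {A : Group.Carrier Γ → Fin n → Fin n}
                  (isAction : IsAction Γ A) (dt : DoublyTransitive Γ A) (p : Fin n) where
  open Group Γ
  open GroupProperties Γ using (⁻¹-involutive)
  open IsAction isAction
  open GroupNotions Γ using (IsSubgroup)
  open GroupLemmas Γ

  Stab : Carrier → Set
  Stab g = A g p ≡ p

  act-inverseˡ : ∀ g i → A (g ⁻¹) (A g i) ≡ i
  act-inverseˡ g i =
    Eq.trans (Eq.sym (act-∙ (g ⁻¹) g i)) (Eq.trans (act-cong (inverseˡ g) i) (act-ε i))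

  act-inverseʳ : ∀ g i → A g (A (g ⁻¹) i) ≡ i
  act-inverseʳ g i =
    Eq.trans (Eq.sym (act-∙ g (g ⁻¹) i)) (Eq.trans (act-cong (inverseʳ g) i) (act-ε i))

  stab-isSubgroup : IsSubgroup Stab
  stab-isSubgroup = record
    { resp = λ {g} {h} g≈h gp≡p → Eq.trans (Eq.sym (act-cong g≈h p)) gp≡p
    ; one  = act-ε p
    ; mul  = λ {g} {h} gp≡p hp≡p → Eq.trans (act-∙ g h p) (Eq.trans (Eq.cong (A g) hp≡p) gp≡p)
    ; inv  = λ {g} gp≡p → Eq.trans (Eq.cong (A (g ⁻¹)) (Eq.sym gp≡p)) (act-inverseˡ g p)
    }

  stab-dec : ∀ g → Dec (Stab g)
  stab-dec g = A g p ≟ p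

  ∉stab⇒⁻¹∉stab : ∀ {g} → ¬ Stab g → ¬ Stab (g ⁻¹)
  ∉stab⇒⁻¹∉stab {g} g∉ g⁻¹p≡p = g∉ (Eq.trans (Eq.cong (A g) (Eq.sym g⁻¹p≡p)) (act-inverseʳ g p))

  stab-transitive : ∀ {q q'} → q ≢ p → q' ≢ p → ∃ λ k → Stab k × A k q ≡ q'
  stab-transitive q≢p q'≢p = dt p _ p _ (λ e → q≢p (Eq.sym e)) (λ e → q'≢p (Eq.sym e))

  stab-bridge : ∀ {g h} → ¬ Stab g → ¬ Stab h → ∃ λ k → Stab k × Stab ((h ∙ k) ∙ g)
  stab-bridge {g} {h} g∉ h∉ with stab-transitive g∉ (∉stab⇒⁻¹∉stab h∉)
  ... | k , k∈ , kgp≡h⁻¹p = k , k∈ , (begin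
    A ((h ∙ k) ∙ g) p    ≡⟨ act-∙ (h ∙ k) g p ⟩
    A (h ∙ k) (A g p)    ≡⟨ act-∙ h k (A g p) ⟩
    A h (A k (A g p))    ≡⟨ Eq.cong (A h) kgp≡h⁻¹p ⟩
    A h (A (h ⁻¹) p)     ≡⟨ act-inverseʳ h p ⟩
    p                    ∎)
    where open Eq.≡-Reasoning

  ∉stab⇒⁻¹∈doubleCoset : ∀ {x} → ¬ Stab x →
                         ∃₂ λ ξ η → Stab ξ × Stab η × x ⁻¹ ≈ (ξ ∙ x) ∙ η
  ∉stab⇒⁻¹∈doubleCoset {x} x∉ with stab-bridge x∉ x∉
  ... | ξ , ξ∈ , xξx∈ =
    ξ , ((x ∙ ξ) ∙ x) ⁻¹ , ξ∈ , IsSubgroup.inv stab-isSubgroup xξx∈ , sym (x∙y∙[z∙x∙y]⁻¹≈z⁻¹ ξ x x)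

  ∉stab-doubleCoset : ComplementIsDoubleCoset Stab
  ∉stab-doubleCoset {x} {x₀} x∉ x₀∉ with stab-bridge x₀∉ (∉stab⇒⁻¹∉stab x∉)
  ... | k₁ , k₁∈ , k₂⁻¹∈ =
    k₁ , ((x ⁻¹ ∙ k₁) ∙ x₀) ⁻¹ , k₁∈ , IsSubgroup.inv stab-isSubgroup k₂⁻¹∈ ,
    sym (trans (x∙y∙[z∙x∙y]⁻¹≈z⁻¹ k₁ x₀ (x ⁻¹)) (⁻¹-involutive x))

  -- conj y ξ fixes p exactly when ξ fixes y⁻¹ p ≠ p, and with n ≥ 3 points
  -- some ξ ∈ Stab moves y⁻¹ p to a third point.
  stab-selfNormalizing : n ≥ 3 → SelfNormalizing Stab
  stab-selfNormalizing n≥3 {y} y∉ with third-point n≥3 p (A (y ⁻¹) p)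
  ... | s , s≢p , s≢y⁻¹p with stab-transitive (∉stab⇒⁻¹∉stab y∉) s≢p
  ... | ξ , ξ∈ , ξy⁻¹p≡s = ξ , ξ∈ , λ conj∈ → s≢y⁻¹p (begin
    s                                ≡⟨ ξy⁻¹p≡s ⟨
    A ξ (A (y ⁻¹) p)                 ≡⟨ act-inverseˡ y _ ⟨
    A (y ⁻¹) (A y (A ξ (A (y ⁻¹) p)))  ≡⟨ Eq.cong (A (y ⁻¹)) (fixes conj∈) ⟩
    A (y ⁻¹) p                       ∎)
    where
    open Eq.≡-Reasoning
    fixes : Stab (conj y ξ) → A y (A ξ (A (y ⁻¹) p)) ≡ p
    fixes conj∈ = Eq.trans (Eq.sym (Eq.trans (act-∙ (y ∙ ξ) (y ⁻¹) p) (act-∙ y ξ _))) conj∈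

module HigmanKey (G* : Group 0ℓ 0ℓ) (S : Group.Carrier G* → Set)
                 (S-sub : GroupNotions.IsSubgroup G* S) (S-dec : ∀ y → Dec (S y))
                 (S-selfNormalizing : GroupLemmas.SelfNormalizing G* S)
                 (∉-doubleCoset : GroupLemmas.ComplementIsDoubleCoset G* S)
                 (r : ℕ) (β : Group.Carrier G* → ℤ) (isβ : IsCharacterOn G* S r β) where
  open Group G* hiding (_-_)
  open GroupProperties G* using (\\-leftDividesˡ)
  open GroupLemmas G*
  open CharacterProperties S-sub isβ using (χ-⁻¹; χ-conj)
  open ≡-mod-Reasoning r
  private
    module S = GroupNotions.IsSubgroup S-sub
    module β = IsCharacterOn isβ

  Γ : Group 0ℓ 0ℓ
  Γ = Gtilde G* r

  private module Γ = Group Γ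
  open GroupNotions Γ using (IsSubgroup; Normalizer; DoubleCoset; IsKey)
  open GroupLemmas Γ using ()
    renaming (conj to conjΓ; conj-x⁻¹≈x⁻¹∙w∙x to conjΓ-x⁻¹≈x⁻¹∙w∙x; doubleCoset-⊆ to doubleCoset-⊆Γ)

  H : Γ.Carrier → Set
  H (y , c) = S y × c + β y ≡ 0ℤ [mod r ]

  ∈H : ∀ {y} → S y → H (y , - β y)
  ∈H {y} sy = sy , Group.reflexive (Cyc r) (ℤP.+-inverseˡ (β y))

  conj-∈H : ∀ {y} c h → S y → H h → H (conjΓ (y , c) h)
  conj-∈H {y} c (t , w) sy (st , w+βt≡0) = conj-closed S-sub sy st , (begin
    ((c + w) - c) + β (conj y t)  ≡⟨ cancel c w (β (conj y t)) ⟩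
    w + β (conj y t)              ≈⟨ +-congˡ w (β (conj y t)) (β t) (χ-conj sy st) ⟩
    w + β t                       ≈⟨ w+βt≡0 ⟩
    0ℤ                            ∎)
    where
    cancel : ∀ c w b → ((c + w) - c) + b ≡ w + b
    cancel = solve-∀

  module _ (H-sub : IsSubgroup H) where
    private module H = IsSubgroup H-sub

    S⇒normalizer : ∀ {y} c → S y → Normalizer H (y , c)
    S⇒normalizer {y} c sy h h∈H =
      conj-∈H c h sy h∈H ,
      H.resp {conjΓ ((y , c) Γ.⁻¹) h} {((y , c) Γ.⁻¹ Γ.∙ h) Γ.∙ (y , c)}
             (conjΓ-x⁻¹≈x⁻¹∙w∙x (y , c) h) (conj-∈H (- c) h (S.inv sy) h∈H)

    normalizer⇒S : ∀ {y} c → Normalizer H (y , c) → S y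
    normalizer⇒S {y} c y∈K with S-dec y
    ... | yes sy = sy
    ... | no y∉ with S-selfNormalizing y∉
    ... | ξ , sξ , conj∉ = contradiction (proj₁ (proj₁ (y∈K (ξ , - β ξ) (∈H sξ)))) conj∉

    inverse-factorisation : ∀ {x z ξ η} → S ξ → S η → x ⁻¹ ≈ (ξ ∙ x) ∙ η →
                            + 2 * z ≡ β (ξ ∙ η) [mod r ] →
                            (x , z) Γ.⁻¹ Γ.≈ ((ξ , - β ξ) Γ.∙ (x , z)) Γ.∙ (η , - β η)
    inverse-factorisation {x} {z} {ξ} {η} sξ sη x⁻¹≈ξxη 2z≡βξη = x⁻¹≈ξxη , (begin
      - z                    ≡⟨ ring₁ z ⟩
      z + - (+ 2 * z)        ≈⟨ +-congˡ z (- (+ 2 * z)) (- (β ξ + β η)) (-‿cong (+ 2 * z) (β ξ + β η) 2z≡βξ+βη) ⟩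
      z + - (β ξ + β η)      ≡⟨ ring₂ z (β ξ) (β η) ⟩
      (- β ξ + z) + - β η    ∎)
      where
      ring₁ : ∀ z → - z ≡ z + - (+ 2 * z)
      ring₁ = solve-∀
      ring₂ : ∀ z a b → z + - (a + b) ≡ (- a + z) + - b
      ring₂ = solve-∀
      2z≡βξ+βη : + 2 * z ≡ β ξ + β η [mod r ]
      2z≡βξ+βη = begin
        + 2 * z      ≈⟨ 2z≡βξη ⟩
        β (ξ ∙ η)    ≈⟨ β.hom sξ sη ⟩
        β ξ + β η    ∎

    HbH≡Hb⁻¹H : ∀ {x z ξ η} → S ξ → S η → x ⁻¹ ≈ (ξ ∙ x) ∙ η →
                + 2 * z ≡ β (ξ ∙ η) [mod r ] → ∀ g →
                (DoubleCoset H (x , z) g → DoubleCoset H ((x , z) Γ.⁻¹) g) ×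
                (DoubleCoset H ((x , z) Γ.⁻¹) g → DoubleCoset H (x , z) g)
    HbH≡Hb⁻¹H {x} {z} {ξ} {η} sξ sη x⁻¹≈ξxη 2z≡βξη g =
      doubleCoset-⊆Γ H-sub {b Γ.⁻¹} {b} {h₁ Γ.⁻¹} {h₂ Γ.⁻¹} b≈ (H.inv {h₁} (∈H sξ)) (H.inv {h₂} (∈H sη)) {g} ,
      doubleCoset-⊆Γ H-sub {b} {b Γ.⁻¹} {h₁} {h₂} b⁻¹≈ (∈H sξ) (∈H sη) {g}
      where
      b h₁ h₂ : Γ.Carrier
      b = x , z
      h₁ = ξ , - β ξ
      h₂ = η , - β η
      b⁻¹≈ : b Γ.⁻¹ Γ.≈ (h₁ Γ.∙ b) Γ.∙ h₂
      b⁻¹≈ = inverse-factorisation {z = z} sξ sη x⁻¹≈ξxη 2z≡βξη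
      b≈ : b Γ.≈ (h₁ Γ.⁻¹ Γ.∙ b Γ.⁻¹) Γ.∙ h₂ Γ.⁻¹
      b≈ = GroupLemmas.x≈a∙y∙c⇒y≈a⁻¹∙x∙c⁻¹ Γ {b Γ.⁻¹} {h₁} {b} {h₂} b⁻¹≈

    normalizer-conj∈HbH : ∀ {x z} a → Normalizer H a →
                          DoubleCoset H (x , z) ((a Γ.∙ (x , z)) Γ.∙ a Γ.⁻¹)
    normalizer-conj∈HbH {x} {z} (y , c) a∈K =
      (y , - β y) , (y ⁻¹ , - β (y ⁻¹)) , ∈H sy , ∈H (S.inv sy) , refl , (begin
        (c + z) + - c            ≡⟨ ring (β y) c z ⟩
        (- β y + z) + β y        ≈⟨ +-congˡ (- β y + z) (β y) (- β (y ⁻¹)) βy≡-βy⁻¹ ⟩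
        (- β y + z) + - β (y ⁻¹) ∎)
      where
      sy : S y
      sy = normalizer⇒S c a∈K
      ring : ∀ b c z → (c + z) + - c ≡ (- b + z) + b
      ring = solve-∀
      βy≡-βy⁻¹ : β y ≡ - β (y ⁻¹) [mod r ]
      βy≡-βy⁻¹ = begin
        β y            ≡⟨ ℤP.neg-involutive (β y) ⟨
        - (- β y)      ≈⟨ -‿cong (β (y ⁻¹)) (- β y) (χ-⁻¹ sy) ⟨
        - β (y ⁻¹)     ∎

    module _ {x₀ z₀} (key₀ : IsKey H (x₀ , z₀)) where
      private module K₀ = IsKey key₀

      x₀∉S : ¬ S x₀
      x₀∉S sx₀ = K₀.notInK (S⇒normalizer z₀ sx₀)

      -- (H5) for the key (x₀ , z₀) and a = (x₀ v x₀⁻¹ , − β v),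
      -- since a (x₀ , z₀) = (x₀ , z₀) (v , − β v).
      β-conj-invariant₀ : ∀ {v} → S v → S (conj x₀ v) → β (conj x₀ v) ≡ β v [mod r ]
      β-conj-invariant₀ {v} sv sconj = begin
        β (conj x₀ v)                  ≡⟨ ring (β (conj x₀ v)) (β v) ⟩
        β v + (- β v + β (conj x₀ v))  ≈⟨ +-congˡ (β v) (- β v + β (conj x₀ v)) 0ℤ (proj₂ a∈H) ⟩
        β v + 0ℤ                       ≡⟨ ℤP.+-identityʳ (β v) ⟩
        β v                            ∎
        where
        ring : ∀ a b → a ≡ b + (- b + a)
        ring = solve-∀
        swap : ∀ a z → - a + z ≡ (0ℤ + z) + - a
        swap = solve-∀
        a∈H : H (conj x₀ v , - β v)
        a∈H = K₀.H5 (conj x₀ v , - β v) (S⇒normalizer (- β v) sconj)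
                (Γ.ε , (v , - β v) , H.one , ∈H sv ,
                 conj∙x≈ε∙x∙w x₀ v , Group.reflexive (Cyc r) (swap (β v) z₀))

      β-conj-invariant : ∀ {x v} → ¬ S x → S v → S (conj x v) → β (conj x v) ≡ β v [mod r ]
      β-conj-invariant {x} {v} x∉ sv sconj =
        let k₁ , k₂ , sk₁ , sk₂ , x≈k₁x₀k₂ = ∉-doubleCoset x∉ x₀∉S
            split : conj x v ≈ conj k₁ (conj x₀ (conj k₂ v))
            split = trans (conj-cong x≈k₁x₀k₂ refl) (trans (conj-∙ _ k₂ v) (conj-∙ k₁ x₀ _))
            st : S (conj x₀ (conj k₂ v))
            st = conj-reflect S-sub sk₁ (S.resp split sconj)
        in begin
        β (conj x v)                      ≈⟨ β.cong sconj (conj-closed S-sub sk₁ st) split ⟩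
        β (conj k₁ (conj x₀ (conj k₂ v))) ≈⟨ χ-conj sk₁ st ⟩
        β (conj x₀ (conj k₂ v))           ≈⟨ β-conj-invariant₀ (conj-closed S-sub sk₂ sv) st ⟩
        β (conj k₂ v)                     ≈⟨ χ-conj sk₂ sv ⟩
        β v                               ∎

      y∙x≈u∙x∙v⇒βy≡βu+βv : ∀ {x y u v} → ¬ S x → S y → S u → S v → y ∙ x ≈ (u ∙ x) ∙ v →
                           β y ≡ β u + β v [mod r ]
      y∙x≈u∙x∙v⇒βy≡βu+βv {x} {y} {u} {v} x∉ sy su sv yx≈uxv = begin
        β y                   ≈⟨ β.cong sy (S.mul su su⁻¹y) (sym (\\-leftDividesˡ u y)) ⟩
        β (u ∙ (u ⁻¹ ∙ y))    ≈⟨ β.hom su su⁻¹y ⟩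
        β u + β (u ⁻¹ ∙ y)    ≈⟨ +-congˡ (β u) (β (u ⁻¹ ∙ y)) (β (conj x v)) (β.cong su⁻¹y sconj u⁻¹y≈conj) ⟩
        β u + β (conj x v)    ≈⟨ +-congˡ (β u) (β (conj x v)) (β v) (β-conj-invariant x∉ sv sconj) ⟩
        β u + β v             ∎
        where
        su⁻¹y : S (u ⁻¹ ∙ y)
        su⁻¹y = S.mul (S.inv su) sy
        u⁻¹y≈conj : u ⁻¹ ∙ y ≈ conj x v
        u⁻¹y≈conj = y∙x≈u∙x∙v⇒u⁻¹∙y≈conj yx≈uxv
        sconj : S (conj x v)
        sconj = S.resp u⁻¹y≈conj su⁻¹y

      translate∈HbH⇒∈H : ∀ {x z} → ¬ S x → ∀ a → Normalizer H a →
                         DoubleCoset H (x , z) (a Γ.∙ (x , z)) → H a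
      translate∈HbH⇒∈H {x} {z} x∉ (y , c) a∈K
        ((u , w₁) , (v , w₂) , (su , w₁+βu≡0) , (sv , w₂+βv≡0) , yx≈uxv , c+z≡) = sy , (begin
          c + β y                              ≡⟨ ring₁ c z (β y) ⟩
          ((c + z) - z) + β y                  ≈⟨ +-congʳ ((c + z) - z) (((w₁ + z) + w₂) - z) (β y)
                                                    (+-congʳ (c + z) ((w₁ + z) + w₂) (- z) c+z≡) ⟩
          (((w₁ + z) + w₂) - z) + β y          ≈⟨ +-congˡ (((w₁ + z) + w₂) - z) (β y) (β u + β v)
                                                    (y∙x≈u∙x∙v⇒βy≡βu+βv x∉ sy su sv yx≈uxv) ⟩
          (((w₁ + z) + w₂) - z) + (β u + β v)  ≡⟨ ring₂ w₁ w₂ z (β u) (β v) ⟩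
          (w₁ + β u) + (w₂ + β v)              ≈⟨ +-cong (w₁ + β u) 0ℤ (w₂ + β v) 0ℤ w₁+βu≡0 w₂+βv≡0 ⟩
          0ℤ                                   ∎)
        where
        sy : S y
        sy = normalizer⇒S c a∈K
        ring₁ : ∀ c z b → c + b ≡ ((c + z) - z) + b
        ring₁ = solve-∀
        ring₂ : ∀ w₁ w₂ z a b → (((w₁ + z) + w₂) - z) + (a + b) ≡ (w₁ + a) + (w₂ + b)
        ring₂ = solve-∀

      isKey : ∀ {x ξ η} → ¬ S x → S ξ → S η → x ⁻¹ ≈ (ξ ∙ x) ∙ η →
              ∀ z → + 2 * z ≡ β (ξ ∙ η) [mod r ] → IsKey H (x , z)
      isKey x∉ sξ sη x⁻¹≈ξxη z 2z≡βξη = record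
        { notInK = λ x∈K → x∉ (normalizer⇒S z x∈K)
        ; H1 = K₀.H1
        ; H2 = K₀.H2
        ; H3 = HbH≡Hb⁻¹H sξ sη x⁻¹≈ξxη 2z≡βξη
        ; H4 = normalizer-conj∈HbH
        ; H5 = translate∈HbH⇒∈H x∉
        }

lemma5p3 : (n : ℕ) → n ≥ 3 →
    (G : Group 0ℓ 0ℓ) (act : Group.Carrier G → Fin n → Fin n) →
    IsPermutationGroup n G act → DoublyTransitive G act →
    (p : Fin n) →
    (G* : Group 0ℓ 0ℓ) (π : Group.Carrier G* → Group.Carrier G) →
    IsSchurCovering G* G π →
    (r' : ℕ) → r' ≥ 1 →
    (α : Group.Carrier G* → ℤ) →
    IsSurjLinearChar G* (Stab* G* G act π p) r' α →
    GroupNotions.HigmanPair (Gtilde G* (2 Data.Nat.* r'))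
      (Hker G* (Stab* G* G act π p) (2 Data.Nat.* r') α) →
    let open Group G* in
    (x : Carrier) → ¬ Stab* G* G act π p x →
    (∃₂ λ ξ η → Stab* G* G act π p ξ × Stab* G* G act π p η × x ⁻¹ ≈ (ξ ∙ x) ∙ η)
    × (∀ ξ η → Stab* G* G act π p ξ → Stab* G* G act π p η → x ⁻¹ ≈ (ξ ∙ x) ∙ η →
        ∀ (z : ℤ) → + 2 * z ≡ + 2 * α (ξ ∙ η) [mod 2 Data.Nat.* r' ] →
        GroupNotions.IsKey (Gtilde G* (2 Data.Nat.* r'))
          (Hker G* (Stab* G* G act π p) (2 Data.Nat.* r') α) (x , z))
lemma5p3 n n≥3 G act isPerm dt p G* π schur r' _ α isα (_ , H-sub , _ , _ , key₀) x x∉S =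
  ∉stab⇒⁻¹∈doubleCoset x∉S , λ _ _ sξ sη → isKey H-sub key₀ x∉S sξ sη
  where
  epi : IsEpimorphism G* G π
  epi = IsSchurCovering.epi schur
  open Stabilizer G* (pullback-isAction epi isPerm) (pullback-doublyTransitive epi isPerm dt) p
  open HigmanKey G* Stab stab-isSubgroup stab-dec (stab-selfNormalizing n≥3) ∉stab-doubleCoset
                 (2 Data.Nat.* r') (λ y → + 2 * α y) (doubled-isCharacterOn isα)
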